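{- Let $x_1$ be an odd positive integer, let $b=\frac{x_1^2+3}{2}-x_1$, and let $c_2$ be a nonnegative integer such that \[ \frac{b^2+3}{2}-b+2c_2>\frac{(x_1-2)x_1b}{2(x_1+b)-x_1^2}. \] For all nonnegative integers $t_1,t_2$, setting $x_2=b+2t_1$ and $x_3=\frac{x_2^2+3}{2}-x_2+2c_2+2t_2$, the rational number $\frac{\sigma_2(x_1,x_2,x_3)}{x_1x_2x_3}=\frac1{x_1}+\frac1{x_2}+\frac1{x_3}$ has odd greedy expansion of length $3$ with denominators $x_1,x_2,x_3$.
   Context: $\sigma_2(x_1,x_2,x_3)=x_1x_2+x_1x_3+x_2x_3$. Odd greedy expansion: given a positive rational $q$, define $x_1,x_2,\dots$ recursively: writing $R_i=q-\sum_{j=1}^{i-1}1/x_j$, if $R_i\ge1$ let $x_i=1$, and if $0<R_i<1$ let $x_i$ be the unique odd positive integer with $\frac1{x_i}\le R_i<\frac1{x_i-2}$; stop when the remainder is $0$. The $x_i$ are the denominators and the number of terms is the length. -}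

module Defs where

open import Data.Nat as ℕ using (ℕ; zero; suc; _∸_; _%_)
import Data.Nat.DivMod as ℕD
open import Data.Integer using (ℤ; +_; -[1+_])
open import Data.Rational using (ℚ; mkℚ; 0ℚ; 1ℚ; _+_; _-_; _*_; _÷_; _≤_; _<_)
import Data.Rational as Q
open import Data.List using (List; []; _∷_)

ℕ→ℚ : ℕ → ℚ
ℕ→ℚ n = (+ n) Q./ 1

-- Total division on ℚ (p ÷ᵗ 0 = 0).  Only ever applied below to
-- nonzero denominators, where it agrees with ordinary division _÷_.
_÷ᵗ_ : ℚ → ℚ → ℚ
p ÷ᵗ mkℚ (+ zero) _ _ = 0ℚ
p ÷ᵗ q@(mkℚ (+ suc _) _ _) = p ÷ q
p ÷ᵗ q@(mkℚ -[1+ _ ] _ _) = p ÷ q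

infixl 7 _÷ᵗ_

unit : ℕ → ℚ
unit x = 1ℚ ÷ᵗ ℕ→ℚ x

σ₂ : ℕ → ℕ → ℕ → ℕ
σ₂ x₁ x₂ x₃ = x₁ ℕ.* x₂ ℕ.+ x₁ ℕ.* x₃ ℕ.+ x₂ ℕ.* x₃

-- OddGreedy q xs : xs is the (terminating) odd greedy expansion of q,
-- i.e. the list of denominators produced by the odd greedy algorithm,
-- which stops exactly when the remainder becomes 0.
--  * remainder R ≥ 1       : next denominator is 1
--  * 0 < R < 1             : next denominator is the odd x ≥ 3 (written
--                            x = 3 + 2m) with 1/x ≤ R < 1/(x-2)
--    (x = 1 can never satisfy 1/x ≤ R < 1/(x-2) when R < 1.)
data OddGreedy : ℚ → List ℕ → Set where
  stop    : OddGreedy 0ℚ []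
  stepOne : ∀ {R xs} → 1ℚ ≤ R → OddGreedy (R - 1ℚ) xs → OddGreedy R (1 ∷ xs)
  stepOdd : ∀ {R xs} (m : ℕ) →
            0ℚ < R → R < 1ℚ →
            unit (3 ℕ.+ 2 ℕ.* m) ≤ R →
            R < unit (1 ℕ.+ 2 ℕ.* m) →
            OddGreedy (R - unit (3 ℕ.+ 2 ℕ.* m)) xs →
            OddGreedy R ((3 ℕ.+ 2 ℕ.* m) ∷ xs)

-- b = (x₁² + 3)/2 - x₁   (exact in ℕ for odd x₁)
bOf : ℕ → ℕ
bOf x₁ = ((x₁ ℕ.* x₁ ℕ.+ 3) ℕD./ 2) ∸ x₁

-- x₃ = (x₂² + 3)/2 - x₂ + 2c₂ + 2t₂   (exact in ℕ for odd x₂)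
x₃Of : ℕ → ℕ → ℕ → ℕ
x₃Of x₂ c₂ t₂ = ((x₂ ℕ.* x₂ ℕ.+ 3) ℕD./ 2) ∸ x₂ ℕ.+ 2 ℕ.* c₂ ℕ.+ 2 ℕ.* t₂

c₂Condition : ℕ → ℕ → Set
c₂Condition x₁ c₂ =
  let b  = ℕ→ℚ (bOf x₁)
      X  = ℕ→ℚ x₁
      two = ℕ→ℚ 2
  in  ((X - two) * X * b) ÷ᵗ (two * (X + b) - X * X)
        < (b * b + ℕ→ℚ 3) ÷ᵗ two - b + two * ℕ→ℚ c₂

-- Write a = x₁, r = a − 2 and b₀ = (a² + 3)/2 − a, so that 2b₀ = r·a + 3.  A sum
-- 1/x₁ + 1/x₂ + 1/x₃ of odd unit fractions has odd greedy expansion (x₁, x₂, x₃) as soon as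
-- every tail 1/xᵢ + … + 1/x₃ with xᵢ ≥ 3 is below 1/(xᵢ − 2): the greedy step then picks xᵢ
-- and leaves the next tail.  For x₂ this holds because x₃ ≥ (x₂² + 3)/2 − x₂.  For x₁ the
-- sum is largest at t₁ = t₂ = 0, where 1/r − 1/a − 1/b₀ = 3/(r·a·b₀); so the bound there
-- says 3·c₀ > r·a·b₀ for c₀ = x₃, which is exactly the hypothesis on c₂ once its
-- denominator 2(a + b₀) − a² is recognised as 3.

module Submission where

open import Defs
open import Data.Nat using (ℕ; zero; suc; _+_; _*_; _∸_; _%_; _/_; _≤_; _<_; s≤s; z≤n)
open import Data.Nat.DivMod using (m≡m%n+[m/n]*n; m*n/n≡m)
import Data.Nat.Properties as ℕₚ
import Data.Nat.Coprimality as Coprimality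
open import Data.Nat.ListAction using (product)
open import Data.Integer as ℤ using (+_)
import Data.Integer.Properties as ℤₚ
open import Data.Rational as ℚ using (ℚ; mkℚ; 0ℚ; 1ℚ; 1/_; Positive)
import Data.Rational.Properties as ℚₚ
import Data.Rational.Unnormalised as ℚᵘ
import Data.Rational.Unnormalised.Properties as ℚᵘₚ
open import Data.Rational.Solver using (module +-*-Solver)
open import Data.Integer.Tactic.RingSolver using () renaming (solve-∀ to solve-∀ℤ)
open import Data.Nat.Tactic.RingSolver using () renaming (solve-∀ to solve-∀ℕ)
open import Data.List using (List; []; _∷_)
open import Data.List.Relation.Unary.All using (All; []; _∷_)
open import Data.List.Relation.Binary.Pointwise using (Pointwise; []; _∷_)
open import Data.Product using (∃; _,_; proj₁; proj₂)
open import Relation.Binary.PropositionalEquality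

open +-*-Solver using (solve; _:+_; _:*_; _:-_; _:=_)

-- Rewriting with this exposes the numerator, on which _÷ᵗ_ and the orders compute.
ℕ→ℚ≡mkℚ : ∀ n → ℕ→ℚ n ≡ mkℚ (+ n) 0 (Coprimality.sym (Coprimality.1-coprimeTo n))
ℕ→ℚ≡mkℚ n = ℚₚ.normalize-coprime (Coprimality.sym (Coprimality.1-coprimeTo n))

toℚᵘ-ℕ→ℚ : ∀ n → ℚ.toℚᵘ (ℕ→ℚ n) ≡ ℚᵘ.mkℚᵘ (+ n) 0
toℚᵘ-ℕ→ℚ n = cong ℚ.toℚᵘ (ℕ→ℚ≡mkℚ n)

ℕ→ℚ-+ : ∀ m n → ℕ→ℚ (m + n) ≡ ℕ→ℚ m ℚ.+ ℕ→ℚ n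
ℕ→ℚ-+ m n = ℚₚ.toℚᵘ-injective (begin
  ℚ.toℚᵘ (ℕ→ℚ (m + n))                   ≡⟨ toℚᵘ-ℕ→ℚ (m + n) ⟩
  ℚᵘ.mkℚᵘ (+ (m + n)) 0                   ≈⟨ ℚᵘ.*≡* (trans (cong (ℤ._* + 1) (ℤₚ.pos-+ m n)) (distrib (+ m) (+ n))) ⟩
  ℚᵘ.mkℚᵘ (+ m) 0 ℚᵘ.+ ℚᵘ.mkℚᵘ (+ n) 0    ≡⟨ sym (cong₂ ℚᵘ._+_ (toℚᵘ-ℕ→ℚ m) (toℚᵘ-ℕ→ℚ n)) ⟩
  ℚ.toℚᵘ (ℕ→ℚ m) ℚᵘ.+ ℚ.toℚᵘ (ℕ→ℚ n)      ≈⟨ ℚᵘₚ.≃-sym (ℚₚ.toℚᵘ-homo-+ (ℕ→ℚ m) (ℕ→ℚ n)) ⟩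
  ℚ.toℚᵘ (ℕ→ℚ m ℚ.+ ℕ→ℚ n)                 ∎)
  where
  open ℚᵘₚ.≃-Reasoning
  distrib : ∀ x y → (x ℤ.+ y) ℤ.* + 1 ≡ (x ℤ.* + 1 ℤ.+ y ℤ.* + 1) ℤ.* + 1
  distrib = solve-∀ℤ

ℕ→ℚ-* : ∀ m n → ℕ→ℚ (m * n) ≡ ℕ→ℚ m ℚ.* ℕ→ℚ n
ℕ→ℚ-* m n = ℚₚ.toℚᵘ-injective (begin
  ℚ.toℚᵘ (ℕ→ℚ (m * n))                   ≡⟨ toℚᵘ-ℕ→ℚ (m * n) ⟩
  ℚᵘ.mkℚᵘ (+ (m * n)) 0                   ≈⟨ ℚᵘ.*≡* (cong (ℤ._* + 1) (ℤₚ.pos-* m n)) ⟩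
  ℚᵘ.mkℚᵘ (+ m) 0 ℚᵘ.* ℚᵘ.mkℚᵘ (+ n) 0    ≡⟨ sym (cong₂ ℚᵘ._*_ (toℚᵘ-ℕ→ℚ m) (toℚᵘ-ℕ→ℚ n)) ⟩
  ℚ.toℚᵘ (ℕ→ℚ m) ℚᵘ.* ℚ.toℚᵘ (ℕ→ℚ n)      ≈⟨ ℚᵘₚ.≃-sym (ℚₚ.toℚᵘ-homo-* (ℕ→ℚ m) (ℕ→ℚ n)) ⟩
  ℚ.toℚᵘ (ℕ→ℚ m ℚ.* ℕ→ℚ n)                 ∎)
  where open ℚᵘₚ.≃-Reasoning

ℕ→ℚ-mono-≤ : ∀ {m n} → m ≤ n → ℕ→ℚ m ℚ.≤ ℕ→ℚ n
ℕ→ℚ-mono-≤ {m} {n} m≤n rewrite ℕ→ℚ≡mkℚ m | ℕ→ℚ≡mkℚ n =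
  ℚ.*≤* (subst₂ ℤ._≤_ (sym (ℤₚ.*-identityʳ (+ m))) (sym (ℤₚ.*-identityʳ (+ n))) (ℤ.+≤+ m≤n))

ℕ→ℚ-mono-< : ∀ {m n} → m < n → ℕ→ℚ m ℚ.< ℕ→ℚ n
ℕ→ℚ-mono-< {m} {n} m<n rewrite ℕ→ℚ≡mkℚ m | ℕ→ℚ≡mkℚ n =
  ℚ.*<* (subst₂ ℤ._<_ (sym (ℤₚ.*-identityʳ (+ m))) (sym (ℤₚ.*-identityʳ (+ n))) (ℤ.+<+ m<n))

ℕ→ℚ-cancel-< : ∀ {m n} → ℕ→ℚ m ℚ.< ℕ→ℚ n → m < n
ℕ→ℚ-cancel-< {m} {n} p rewrite ℕ→ℚ≡mkℚ m | ℕ→ℚ≡mkℚ n with p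
... | ℚ.*<* m<n rewrite ℤₚ.*-identityʳ (+ m) | ℤₚ.*-identityʳ (+ n) = ℤₚ.drop‿+<+ m<n

ℕ→ℚ-pos : ∀ {n} → 0 < n → Positive (ℕ→ℚ n)
ℕ→ℚ-pos {suc n} _ = subst Positive (sym (ℕ→ℚ≡mkℚ (suc n))) _

÷ᵗ-*-cancel : ∀ {n} → 0 < n → ∀ p → (p ÷ᵗ ℕ→ℚ n) ℚ.* ℕ→ℚ n ≡ p
÷ᵗ-*-cancel {suc n} _ p rewrite ℕ→ℚ≡mkℚ (suc n) = begin
  p ℚ.* 1/ q ℚ.* q    ≡⟨ ℚₚ.*-assoc p (1/ q) q ⟩
  p ℚ.* (1/ q ℚ.* q)  ≡⟨ cong (p ℚ.*_) (ℚₚ.*-inverseˡ q) ⟩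
  p ℚ.* 1ℚ            ≡⟨ ℚₚ.*-identityʳ p ⟩
  p                   ∎
  where
  open ≡-Reasoning
  q = mkℚ (+ suc n) 0 (Coprimality.sym (Coprimality.1-coprimeTo (suc n)))

*-÷ᵗ-cancel : ∀ {n} → 0 < n → ∀ p → (p ℚ.* ℕ→ℚ n) ÷ᵗ ℕ→ℚ n ≡ p
*-÷ᵗ-cancel {suc n} _ p rewrite ℕ→ℚ≡mkℚ (suc n) = begin
  p ℚ.* q ℚ.* 1/ q    ≡⟨ ℚₚ.*-assoc p q (1/ q) ⟩
  p ℚ.* (q ℚ.* 1/ q)  ≡⟨ cong (p ℚ.*_) (ℚₚ.*-inverseʳ q) ⟩
  p ℚ.* 1ℚ            ≡⟨ ℚₚ.*-identityʳ p ⟩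
  p                   ∎
  where
  open ≡-Reasoning
  q = mkℚ (+ suc n) 0 (Coprimality.sym (Coprimality.1-coprimeTo (suc n)))

÷ᵗ-unique : ∀ {n p q} → 0 < n → q ℚ.* ℕ→ℚ n ≡ p → p ÷ᵗ ℕ→ℚ n ≡ q
÷ᵗ-unique {n} {q = q} 0<n refl = *-÷ᵗ-cancel 0<n q

unit-*-ℕ→ℚ : ∀ {n} → 0 < n → unit n ℚ.* ℕ→ℚ n ≡ 1ℚ
unit-*-ℕ→ℚ 0<n = ÷ᵗ-*-cancel 0<n 1ℚ

p≤p+q : ∀ p {q} → 0ℚ ℚ.≤ q → p ℚ.≤ p ℚ.+ q
p≤p+q p 0≤q = subst (ℚ._≤ p ℚ.+ _) (ℚₚ.+-identityʳ p) (ℚₚ.+-monoʳ-≤ p 0≤q)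

p+q-p≡q : ∀ p q → p ℚ.+ q ℚ.- p ≡ q
p+q-p≡q = solve 2 (λ p q → p :+ q :- p := q) refl

*ℕ→ℚ-cancelʳ-< : ∀ {p q m n} k → 0 < k → p ℚ.* ℕ→ℚ k ≡ ℕ→ℚ m → q ℚ.* ℕ→ℚ k ≡ ℕ→ℚ n → m < n → p ℚ.< q
*ℕ→ℚ-cancelʳ-< k 0<k pk qk m<n = ℚₚ.*-cancelʳ-<-nonNeg (ℕ→ℚ k) {{ℚₚ.pos⇒nonNeg (ℕ→ℚ k) {{ℕ→ℚ-pos 0<k}}}}
  (subst₂ ℚ._<_ (sym pk) (sym qk) (ℕ→ℚ-mono-< m<n))

*ℕ→ℚ-cancelʳ-≤ : ∀ {p q m n} k → 0 < k → p ℚ.* ℕ→ℚ k ≡ ℕ→ℚ m → q ℚ.* ℕ→ℚ k ≡ ℕ→ℚ n → m ≤ n → p ℚ.≤ q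
*ℕ→ℚ-cancelʳ-≤ k 0<k pk qk m≤n = ℚₚ.*-cancelʳ-≤-pos (ℕ→ℚ k) {{ℕ→ℚ-pos 0<k}}
  (subst₂ ℚ._≤_ (sym pk) (sym qk) (ℕ→ℚ-mono-≤ m≤n))

unit-*-ℕ→ℚ-* : ∀ {m} n → 0 < m → unit m ℚ.* ℕ→ℚ (m * n) ≡ ℕ→ℚ n
unit-*-ℕ→ℚ-* {m} n 0<m = begin
  unit m ℚ.* ℕ→ℚ (m * n)               ≡⟨ cong (unit m ℚ.*_) (ℕ→ℚ-* m n) ⟩
  unit m ℚ.* (ℕ→ℚ m ℚ.* ℕ→ℚ n)         ≡⟨ ℚₚ.*-assoc (unit m) (ℕ→ℚ m) (ℕ→ℚ n) ⟨
  unit m ℚ.* ℕ→ℚ m ℚ.* ℕ→ℚ n           ≡⟨ cong (ℚ._* ℕ→ℚ n) (unit-*-ℕ→ℚ 0<m) ⟩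
  1ℚ ℚ.* ℕ→ℚ n                         ≡⟨ ℚₚ.*-identityˡ (ℕ→ℚ n) ⟩
  ℕ→ℚ n                                ∎
  where open ≡-Reasoning

unit-pos : ∀ {n} → 0 < n → 0ℚ ℚ.< unit n
unit-pos {n} 0<n = *ℕ→ℚ-cancelʳ-< {m = 0} {n = 1} n 0<n (ℚₚ.*-zeroˡ (ℕ→ℚ n)) (unit-*-ℕ→ℚ 0<n) (s≤s z≤n)

unit-nonNeg : ∀ n → 0ℚ ℚ.≤ unit n
unit-nonNeg zero    = ℚₚ.≤-refl
unit-nonNeg (suc n) = ℚₚ.<⇒≤ (unit-pos {suc n} (s≤s z≤n))

unit-antitone : ∀ {m n} → 0 < m → m ≤ n → unit n ℚ.≤ unit m
unit-antitone {m} {n} 0<m m≤n = *ℕ→ℚ-cancelʳ-≤ {m = m} {n = n} (n * m) (ℕₚ.*-mono-< 0<n 0<m)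
  (unit-*-ℕ→ℚ-* m 0<n) (trans (cong (λ k → unit m ℚ.* ℕ→ℚ k) (ℕₚ.*-comm n m)) (unit-*-ℕ→ℚ-* n 0<m)) m≤n
  where 0<n = ℕₚ.<-≤-trans 0<m m≤n

unitSum : List ℕ → ℚ
unitSum []       = 0ℚ
unitSum (x ∷ xs) = unit x ℚ.+ unitSum xs

-- Σᵢ Πⱼ≢ᵢ xⱼ, the elementary symmetric polynomial of degree n − 1 in the n entries
cofactorSum : List ℕ → ℕ
cofactorSum []       = 0
cofactorSum (x ∷ xs) = product xs + x * cofactorSum xs

product-pos : ∀ {xs} → All (0 <_) xs → 0 < product xs
product-pos []         = s≤s z≤n
product-pos (px ∷ pxs) = ℕₚ.*-mono-< px (product-pos pxs)

unitSum-*-product : ∀ {xs} → All (0 <_) xs → unitSum xs ℚ.* ℕ→ℚ (product xs) ≡ ℕ→ℚ (cofactorSum xs)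
unitSum-*-product []                     = ℚₚ.*-zeroˡ (ℕ→ℚ 1)
unitSum-*-product {x ∷ xs} (0<x ∷ pxs) = begin
  (unit x ℚ.+ S) ℚ.* ℕ→ℚ (x * P)                        ≡⟨ cong ((unit x ℚ.+ S) ℚ.*_) (ℕ→ℚ-* x P) ⟩
  (unit x ℚ.+ S) ℚ.* (ℕ→ℚ x ℚ.* ℕ→ℚ P)                  ≡⟨ expand (unit x) S (ℕ→ℚ x) (ℕ→ℚ P) ⟩
  unit x ℚ.* ℕ→ℚ x ℚ.* ℕ→ℚ P ℚ.+ ℕ→ℚ x ℚ.* (S ℚ.* ℕ→ℚ P)
    ≡⟨ cong₂ (λ u v → u ℚ.* ℕ→ℚ P ℚ.+ ℕ→ℚ x ℚ.* v) (unit-*-ℕ→ℚ 0<x) (unitSum-*-product pxs) ⟩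
  1ℚ ℚ.* ℕ→ℚ P ℚ.+ ℕ→ℚ x ℚ.* ℕ→ℚ (cofactorSum xs)
    ≡⟨ cong₂ ℚ._+_ (ℚₚ.*-identityˡ (ℕ→ℚ P)) (sym (ℕ→ℚ-* x (cofactorSum xs))) ⟩
  ℕ→ℚ P ℚ.+ ℕ→ℚ (x * cofactorSum xs)                     ≡⟨ ℕ→ℚ-+ P (x * cofactorSum xs) ⟨
  ℕ→ℚ (P + x * cofactorSum xs)                           ∎
  where
  open ≡-Reasoning
  S = unitSum xs
  P = product xs
  expand : ∀ u s y p → (u ℚ.+ s) ℚ.* (y ℚ.* p) ≡ u ℚ.* y ℚ.* p ℚ.+ y ℚ.* (s ℚ.* p)
  expand = solve 4 (λ u s y p → (u :+ s) :* (y :* p) := u :* y :* p :+ y :* (s :* p)) refl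

unitSum<unit : ∀ r xs → 0 < r → All (0 <_) xs → r * cofactorSum xs < product xs → unitSum xs ℚ.< unit r
unitSum<unit r xs 0<r pxs = *ℕ→ℚ-cancelʳ-< {m = r * cofactorSum xs} {n = product xs} (r * product xs)
  (ℕₚ.*-mono-< 0<r (product-pos pxs)) scaled-sum (unit-*-ℕ→ℚ-* (product xs) 0<r)
  where
  open ≡-Reasoning
  R = ℕ→ℚ r
  P = ℕ→ℚ (product xs)
  scaled-sum : unitSum xs ℚ.* ℕ→ℚ (r * product xs) ≡ ℕ→ℚ (r * cofactorSum xs)
  scaled-sum = begin
    unitSum xs ℚ.* ℕ→ℚ (r * product xs)    ≡⟨ cong (unitSum xs ℚ.*_) (ℕ→ℚ-* r (product xs)) ⟩
    unitSum xs ℚ.* (R ℚ.* P)               ≡⟨ swap (unitSum xs) R P ⟩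
    R ℚ.* (unitSum xs ℚ.* P)               ≡⟨ cong (R ℚ.*_) (unitSum-*-product pxs) ⟩
    R ℚ.* ℕ→ℚ (cofactorSum xs)             ≡⟨ ℕ→ℚ-* r (cofactorSum xs) ⟨
    ℕ→ℚ (r * cofactorSum xs)               ∎
    where
    swap : ∀ s r p → s ℚ.* (r ℚ.* p) ≡ r ℚ.* (s ℚ.* p)
    swap = solve 3 (λ s r p → s :* (r :* p) := r :* (s :* p)) refl

unitSum-nonNeg : ∀ xs → 0ℚ ℚ.≤ unitSum xs
unitSum-nonNeg []       = ℚₚ.≤-refl
unitSum-nonNeg (x ∷ xs) = ℚₚ.+-mono-≤ (unit-nonNeg x) (unitSum-nonNeg xs)

unitSum-antitone : ∀ {xs ys} → All (0 <_) xs → Pointwise _≤_ xs ys → unitSum ys ℚ.≤ unitSum xs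
unitSum-antitone []          []            = ℚₚ.≤-refl
unitSum-antitone (0<x ∷ pxs) (x≤y ∷ xs≤ys) = ℚₚ.+-mono-≤ (unit-antitone 0<x x≤y) (unitSum-antitone pxs xs≤ys)

σ₂÷product≡unitSum : ∀ {a b c} → 0 < a → 0 < b → 0 < c →
  ℕ→ℚ (σ₂ a b c) ÷ᵗ ℕ→ℚ (a * b * c) ≡ unitSum (a ∷ b ∷ c ∷ [])
σ₂÷product≡unitSum {a} {b} {c} 0<a 0<b 0<c = ÷ᵗ-unique (ℕₚ.*-mono-< (ℕₚ.*-mono-< 0<a 0<b) 0<c)
  (trans (cong (λ n → unitSum (a ∷ b ∷ c ∷ []) ℚ.* ℕ→ℚ n) (product≡ a b c))
         (trans (unitSum-*-product positive) (cong ℕ→ℚ (cofactorSum≡σ₂ a b c))))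
  where
  positive = 0<a ∷ 0<b ∷ 0<c ∷ []
  product≡ : ∀ a b c → a * b * c ≡ a * (b * (c * 1))
  product≡ = solve-∀ℕ
  cofactorSum≡σ₂ : ∀ a b c → b * (c * 1) + a * (c * 1 + b * (1 + c * 0)) ≡ a * b + a * c + b * c
  cofactorSum≡σ₂ = solve-∀ℕ

data Odd : ℕ → Set where
  one  : Odd 1
  3+2* : ∀ m → Odd (3 + 2 * m)

Odd⇒pos : ∀ {x} → Odd x → 0 < x
Odd⇒pos one      = s≤s z≤n
Odd⇒pos (3+2* m) = s≤s z≤n

oddGreedy-∷ : ∀ {x xs} → Odd x →
  (∀ m → x ≡ 3 + 2 * m → unitSum (x ∷ xs) ℚ.< unit (1 + 2 * m)) →
  OddGreedy (unitSum xs) xs → OddGreedy (unitSum (x ∷ xs)) (x ∷ xs)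
oddGreedy-∷ {xs = xs} one _ greedy =
  stepOne (p≤p+q 1ℚ (unitSum-nonNeg xs)) (subst (λ S → OddGreedy S xs) (sym (p+q-p≡q 1ℚ (unitSum xs))) greedy)
oddGreedy-∷ {xs = xs} (3+2* m) below greedy =
  stepOdd m (ℚₚ.<-≤-trans (unit-pos {3 + 2 * m} (s≤s z≤n)) u≤sum)
    (ℚₚ.<-≤-trans (below m refl) (unit-antitone {1} {1 + 2 * m} (s≤s z≤n) (s≤s z≤n)))
    u≤sum (below m refl) (subst (λ S → OddGreedy S xs) (sym (p+q-p≡q u (unitSum xs))) greedy)
  where
  u = unit (3 + 2 * m)
  u≤sum = p≤p+q u (unitSum-nonNeg xs)

<-of-≡-+ : ∀ {m n} d → n ≡ m + suc d → m < n
<-of-≡-+ {m} d refl = ℕₚ.m<m+n m (s≤s z≤n)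

oddGreedy-[_] : ∀ {x} → Odd x → OddGreedy (unitSum (x ∷ [])) (x ∷ [])
oddGreedy-[_] {x} odd = oddGreedy-∷ odd below stop
  where
  gap : ∀ m → (3 + 2 * m) * 1 ≡ (1 + 2 * m) * (1 + (3 + 2 * m) * 0) + 2
  gap = solve-∀ℕ
  below : ∀ m → x ≡ 3 + 2 * m → unitSum (x ∷ []) ℚ.< unit (1 + 2 * m)
  below m x≡ = subst (λ y → unitSum (y ∷ []) ℚ.< unit (1 + 2 * m)) (sym x≡)
    (unitSum<unit (1 + 2 * m) (3 + 2 * m ∷ []) (s≤s z≤n) (s≤s z≤n ∷ []) (<-of-≡-+ 1 (gap m)))

3+2*≡1+2*suc : ∀ m → 3 + 2 * m ≡ 1 + 2 * suc m
3+2*≡1+2*suc = solve-∀ℕ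

odd-1+2* : ∀ j → Odd (1 + 2 * j)
odd-1+2* zero    = one
odd-1+2* (suc j) = subst Odd (3+2*≡1+2*suc j) (3+2* j)

%2≡1⇒1+2* : ∀ {x} → x % 2 ≡ 1 → ∃ λ j → x ≡ 1 + 2 * j
%2≡1⇒1+2* {x} x%2≡1 = x / 2 , trans (m≡m%n+[m/n]*n x 2) (cong₂ _+_ x%2≡1 (ℕₚ.*-comm (x / 2) 2))

1+2*-injective : ∀ {j k} → 1 + 2 * j ≡ 1 + 2 * k → j ≡ k
1+2*-injective {j} {k} eq = ℕₚ.*-cancelˡ-≡ j k 2 (ℕₚ.suc-injective eq)

bOf-1+2* : ∀ j → bOf (1 + 2 * j) ≡ 1 + 2 * (j * j)
bOf-1+2* j = begin
  ((1 + 2 * j) * (1 + 2 * j) + 3) / 2 ∸ (1 + 2 * j)   ≡⟨ cong (λ n → n / 2 ∸ (1 + 2 * j)) (square+3 j) ⟩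
  ((1 + 2 * (j * j) + (1 + 2 * j)) * 2) / 2 ∸ (1 + 2 * j)
    ≡⟨ cong (_∸ (1 + 2 * j)) (m*n/n≡m (1 + 2 * (j * j) + (1 + 2 * j)) 2) ⟩
  1 + 2 * (j * j) + (1 + 2 * j) ∸ (1 + 2 * j)          ≡⟨ ℕₚ.m+n∸n≡m (1 + 2 * (j * j)) (1 + 2 * j) ⟩
  1 + 2 * (j * j)                                      ∎
  where
  open ≡-Reasoning
  square+3 : ∀ j → (1 + 2 * j) * (1 + 2 * j) + 3 ≡ (1 + 2 * (j * j) + (1 + 2 * j)) * 2
  square+3 = solve-∀ℕ

1+2*-+-2* : ∀ i t → 1 + 2 * i + 2 * t ≡ 1 + 2 * (i + t)
1+2*-+-2* = solve-∀ℕ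

bOf≤x₃Of : ∀ x c t → bOf x ≤ x₃Of x c t
bOf≤x₃Of x c t = ℕₚ.≤-trans (ℕₚ.m≤m+n (bOf x) (2 * c)) (ℕₚ.m≤m+n (bOf x + 2 * c) (2 * t))

bOf-3+2* : ∀ m → bOf (3 + 2 * m) ≡ 1 + 2 * (suc m * suc m)
bOf-3+2* m = trans (cong bOf (3+2*≡1+2*suc m)) (bOf-1+2* (suc m))

x₂-bound : ∀ m {c} → bOf (3 + 2 * m) ≤ c → unitSum (3 + 2 * m ∷ c ∷ []) ℚ.< unit (1 + 2 * m)
x₂-bound m {c} bOf≤c = ℚₚ.≤-<-trans shrink base
  where
  c₀ = 1 + 2 * (suc m * suc m)
  gap : ∀ m → (3 + 2 * m) * ((1 + 2 * (suc m * suc m)) * 1)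
            ≡ (1 + 2 * m) * ((1 + 2 * (suc m * suc m)) * 1 + (3 + 2 * m) * (1 + (1 + 2 * (suc m * suc m)) * 0)) + 3
  gap = solve-∀ℕ
  base : unitSum (3 + 2 * m ∷ c₀ ∷ []) ℚ.< unit (1 + 2 * m)
  base = unitSum<unit (1 + 2 * m) (3 + 2 * m ∷ c₀ ∷ []) (s≤s z≤n) (s≤s z≤n ∷ s≤s z≤n ∷ []) (<-of-≡-+ 2 (gap m))
  shrink : unitSum (3 + 2 * m ∷ c ∷ []) ℚ.≤ unitSum (3 + 2 * m ∷ c₀ ∷ [])
  shrink = unitSum-antitone (s≤s z≤n ∷ s≤s z≤n ∷ []) (ℕₚ.≤-refl {3 + 2 * m} ∷ subst (_≤ c) (bOf-3+2* m) bOf≤c ∷ [])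

bOf-mono-+2* : ∀ k t → bOf (1 + 2 * k) ≤ bOf (1 + 2 * k + 2 * t)
bOf-mono-+2* k t = begin
  bOf (1 + 2 * k)               ≡⟨ bOf-1+2* k ⟩
  1 + 2 * (k * k)               ≤⟨ ℕₚ.+-monoʳ-≤ 1 (ℕₚ.*-monoʳ-≤ 2 (ℕₚ.*-mono-≤ k≤k+t k≤k+t)) ⟩
  1 + 2 * ((k + t) * (k + t))   ≡⟨ bOf-1+2* (k + t) ⟨
  bOf (1 + 2 * (k + t))         ≡⟨ cong bOf (1+2*-+-2* k t) ⟨
  bOf (1 + 2 * k + 2 * t)       ∎
  where
  open ℕₚ.≤-Reasoning
  k≤k+t = ℕₚ.m≤m+n k t

-- a·b₀·c₀ − r·(b₀c₀ + a c₀ + a b₀) = (2b₀ − r·a)·c₀ − r·a·b₀ = 3c₀ − r·a·b₀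
x₁-bound₀ : ∀ {j m} c₀ → j ≡ suc m → let r = 1 + 2 * m ; a = 1 + 2 * j ; b₀ = 1 + 2 * (j * j) in
  r * a * b₀ < 3 * c₀ → r * cofactorSum (a ∷ b₀ ∷ c₀ ∷ []) < product (a ∷ b₀ ∷ c₀ ∷ [])
x₁-bound₀ {m = m} c₀ refl h = ℕₚ.+-cancelʳ-< (3 * c₀) _ _ (begin-strict
  r * cofactorSum (a ∷ b₀ ∷ c₀ ∷ []) + 3 * c₀   ≡⟨ balance m c₀ ⟨
  product (a ∷ b₀ ∷ c₀ ∷ []) + r * a * b₀       <⟨ ℕₚ.+-monoʳ-< (product (a ∷ b₀ ∷ c₀ ∷ [])) h ⟩
  product (a ∷ b₀ ∷ c₀ ∷ []) + 3 * c₀           ∎)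
  where
  open ℕₚ.≤-Reasoning
  r = 1 + 2 * m
  a = 1 + 2 * suc m
  b₀ = 1 + 2 * (suc m * suc m)
  balance : ∀ m c →
    (1 + 2 * suc m) * ((1 + 2 * (suc m * suc m)) * (c * 1)) + (1 + 2 * m) * (1 + 2 * suc m) * (1 + 2 * (suc m * suc m))
    ≡ (1 + 2 * m) * ((1 + 2 * (suc m * suc m)) * (c * 1)
                      + (1 + 2 * suc m) * (c * 1 + (1 + 2 * (suc m * suc m)) * (1 + c * 0))) + 3 * c
  balance = solve-∀ℕ

bOf-spec : ∀ {x} j → x ≡ 1 + 2 * j → (x + bOf x) * 2 ≡ x * x + 3
bOf-spec j refl = trans (cong (λ b → (1 + 2 * j + b) * 2) (bOf-1+2* j)) (expand j)
  where
  expand : ∀ j → (1 + 2 * j + (1 + 2 * (j * j))) * 2 ≡ (1 + 2 * j) * (1 + 2 * j) + 3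
  expand = solve-∀ℕ

bOf-specℚ : ∀ {x} j → x ≡ 1 + 2 * j →
  (ℕ→ℚ x ℚ.+ ℕ→ℚ (bOf x)) ℚ.* ℕ→ℚ 2 ≡ ℕ→ℚ x ℚ.* ℕ→ℚ x ℚ.+ ℕ→ℚ 3
bOf-specℚ {x} j x≡ = begin
  (ℕ→ℚ x ℚ.+ ℕ→ℚ (bOf x)) ℚ.* ℕ→ℚ 2   ≡⟨ cong (ℚ._* ℕ→ℚ 2) (ℕ→ℚ-+ x (bOf x)) ⟨
  ℕ→ℚ (x + bOf x) ℚ.* ℕ→ℚ 2           ≡⟨ ℕ→ℚ-* (x + bOf x) 2 ⟨
  ℕ→ℚ ((x + bOf x) * 2)               ≡⟨ cong ℕ→ℚ (bOf-spec j x≡) ⟩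
  ℕ→ℚ (x * x + 3)                     ≡⟨ ℕ→ℚ-+ (x * x) 3 ⟩
  ℕ→ℚ (x * x) ℚ.+ ℕ→ℚ 3               ≡⟨ cong (ℚ._+ ℕ→ℚ 3) (ℕ→ℚ-* x x) ⟩
  ℕ→ℚ x ℚ.* ℕ→ℚ x ℚ.+ ℕ→ℚ 3           ∎
  where open ≡-Reasoning

c₂Condition⇒bound₀ : ∀ {r} j c₂ → 1 + 2 * j ≡ 2 + r → c₂Condition (1 + 2 * j) c₂ →
  r * (1 + 2 * j) * bOf (1 + 2 * j) < 3 * (bOf (bOf (1 + 2 * j)) + 2 * c₂)
c₂Condition⇒bound₀ {r} j c₂ a≡2+r cond =
  subst (r * a * b₀ <_) (ℕₚ.*-comm c₀ 3) (ℕ→ℚ-cancel-< cleared)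
  where
  a = 1 + 2 * j
  b₀ = bOf a
  c₀ = bOf b₀ + 2 * c₂
  X = ℕ→ℚ a
  B = ℕ→ℚ b₀
  two = ℕ→ℚ 2
  three = ℕ→ℚ 3
  numerator : (X ℚ.- two) ℚ.* X ℚ.* B ≡ ℕ→ℚ (r * a * b₀)
  numerator = begin
    (X ℚ.- two) ℚ.* X ℚ.* B              ≡⟨ cong (λ y → (y ℚ.- two) ℚ.* X ℚ.* B) (trans (cong ℕ→ℚ a≡2+r) (ℕ→ℚ-+ 2 r)) ⟩
    (two ℚ.+ ℕ→ℚ r ℚ.- two) ℚ.* X ℚ.* B  ≡⟨ cong (λ y → y ℚ.* X ℚ.* B) (p+q-p≡q two (ℕ→ℚ r)) ⟩
    ℕ→ℚ r ℚ.* X ℚ.* B                    ≡⟨ cong (ℚ._* B) (ℕ→ℚ-* r a) ⟨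
    ℕ→ℚ (r * a) ℚ.* B                    ≡⟨ ℕ→ℚ-* (r * a) b₀ ⟨
    ℕ→ℚ (r * a * b₀)                     ∎
    where open ≡-Reasoning
  denominator : two ℚ.* (X ℚ.+ B) ℚ.- X ℚ.* X ≡ three
  denominator = trans (cong (ℚ._- X ℚ.* X) (trans (ℚₚ.*-comm two (X ℚ.+ B)) (bOf-specℚ j refl)))
                      (p+q-p≡q (X ℚ.* X) three)
  bound : (B ℚ.* B ℚ.+ three) ÷ᵗ two ℚ.- B ℚ.+ two ℚ.* ℕ→ℚ c₂ ≡ ℕ→ℚ c₀
  bound = begin
    (B ℚ.* B ℚ.+ three) ÷ᵗ two ℚ.- B ℚ.+ two ℚ.* ℕ→ℚ c₂
      ≡⟨ cong (λ y → y ℚ.- B ℚ.+ two ℚ.* ℕ→ℚ c₂) (÷ᵗ-unique {2} {q = B ℚ.+ ℕ→ℚ (bOf b₀)} (s≤s z≤n) (bOf-specℚ (j * j) (bOf-1+2* j))) ⟩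
    B ℚ.+ ℕ→ℚ (bOf b₀) ℚ.- B ℚ.+ two ℚ.* ℕ→ℚ c₂
      ≡⟨ cong (ℚ._+ two ℚ.* ℕ→ℚ c₂) (p+q-p≡q B (ℕ→ℚ (bOf b₀))) ⟩
    ℕ→ℚ (bOf b₀) ℚ.+ two ℚ.* ℕ→ℚ c₂      ≡⟨ cong (ℕ→ℚ (bOf b₀) ℚ.+_) (ℕ→ℚ-* 2 c₂) ⟨
    ℕ→ℚ (bOf b₀) ℚ.+ ℕ→ℚ (2 * c₂)        ≡⟨ ℕ→ℚ-+ (bOf b₀) (2 * c₂) ⟨
    ℕ→ℚ c₀                               ∎
    where open ≡-Reasoning
  reduced : ℕ→ℚ (r * a * b₀) ÷ᵗ three ℚ.< ℕ→ℚ c₀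
  reduced = subst₂ ℚ._<_ (cong₂ _÷ᵗ_ numerator denominator) bound cond
  scaled : (ℕ→ℚ (r * a * b₀) ÷ᵗ three) ℚ.* three ℚ.< ℕ→ℚ c₀ ℚ.* three
  scaled = ℚₚ.*-monoˡ-<-pos three {{ℕ→ℚ-pos {3} (s≤s z≤n)}} reduced
  cleared : ℕ→ℚ (r * a * b₀) ℚ.< ℕ→ℚ (c₀ * 3)
  cleared = subst₂ ℚ._<_ (÷ᵗ-*-cancel {3} (s≤s z≤n) _) (sym (ℕ→ℚ-* c₀ 3)) scaled

x₁-bound : ∀ {j m} c₂ t₁ t₂ → 1 + 2 * j ≡ 3 + 2 * m → c₂Condition (1 + 2 * j) c₂ →
  let b = bOf (1 + 2 * j) + 2 * t₁ in unitSum (1 + 2 * j ∷ b ∷ x₃Of b c₂ t₂ ∷ []) ℚ.< unit (1 + 2 * m)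
x₁-bound {j} {m} c₂ t₁ t₂ a≡3+2m cond = ℚₚ.≤-<-trans shrink base
  where
  r = 1 + 2 * m
  a = 1 + 2 * j
  b₀ = 1 + 2 * (j * j)
  c₀ = bOf b₀ + 2 * c₂
  b = bOf a + 2 * t₁
  b₀≡ : bOf a ≡ b₀
  b₀≡ = bOf-1+2* j
  hyp : r * a * b₀ < 3 * c₀
  hyp = subst (λ y → r * a * y < 3 * (bOf y + 2 * c₂)) b₀≡ (c₂Condition⇒bound₀ j c₂ a≡3+2m cond)
  0<c₀ : 0 < c₀
  0<c₀ = subst (λ y → 0 < y + 2 * c₂) (sym (bOf-1+2* (j * j))) (s≤s z≤n)
  j≡suc-m : j ≡ suc m
  j≡suc-m = 1+2*-injective (trans a≡3+2m (3+2*≡1+2*suc m))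
  base : unitSum (a ∷ b₀ ∷ c₀ ∷ []) ℚ.< unit r
  base = unitSum<unit r (a ∷ b₀ ∷ c₀ ∷ []) (s≤s z≤n) (s≤s z≤n ∷ s≤s z≤n ∷ 0<c₀ ∷ []) (x₁-bound₀ c₀ j≡suc-m hyp)
  b₀≤b : b₀ ≤ b
  b₀≤b = subst (_≤ b) b₀≡ (ℕₚ.m≤m+n (bOf a) (2 * t₁))
  c₀≤c : c₀ ≤ x₃Of b c₂ t₂
  c₀≤c = ℕₚ.≤-trans
    (ℕₚ.+-monoˡ-≤ (2 * c₂) (subst (λ y → bOf b₀ ≤ bOf (y + 2 * t₁)) (sym b₀≡) (bOf-mono-+2* (j * j) t₁)))
    (ℕₚ.m≤m+n (bOf b + 2 * c₂) (2 * t₂))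
  shrink : unitSum (a ∷ b ∷ x₃Of b c₂ t₂ ∷ []) ℚ.≤ unitSum (a ∷ b₀ ∷ c₀ ∷ [])
  shrink = unitSum-antitone (s≤s z≤n ∷ s≤s z≤n ∷ 0<c₀ ∷ []) (ℕₚ.≤-refl {a} ∷ b₀≤b ∷ c₀≤c ∷ [])

oddGreedy-σ₂/product : ∀ j c₂ t₁ t₂ → c₂Condition (1 + 2 * j) c₂ →
  let x₁ = 1 + 2 * j
      x₂ = bOf x₁ + 2 * t₁
      x₃ = x₃Of x₂ c₂ t₂
  in  OddGreedy (ℕ→ℚ (σ₂ x₁ x₂ x₃) ÷ᵗ ℕ→ℚ (x₁ * x₂ * x₃)) (x₁ ∷ x₂ ∷ x₃ ∷ [])
oddGreedy-σ₂/product j c₂ t₁ t₂ cond = subst (λ q → OddGreedy q (x₁ ∷ x₂ ∷ x₃ ∷ []))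
  (sym (σ₂÷product≡unitSum (Odd⇒pos odd₁) (Odd⇒pos odd₂) (Odd⇒pos odd₃)))
  (oddGreedy-∷ odd₁ (λ m eq → x₁-bound {j} {m} c₂ t₁ t₂ eq cond) (oddGreedy-∷ odd₂ x₂-below oddGreedy-[ odd₃ ]))
  where
  x₁ = 1 + 2 * j
  k = j * j + t₁
  x₂ = bOf x₁ + 2 * t₁
  x₃ = x₃Of x₂ c₂ t₂
  x₂≡ : x₂ ≡ 1 + 2 * k
  x₂≡ = trans (cong (_+ 2 * t₁) (bOf-1+2* j)) (1+2*-+-2* (j * j) t₁)
  x₃≡ : x₃ ≡ 1 + 2 * (k * k + c₂ + t₂)
  x₃≡ = begin
    bOf x₂ + 2 * c₂ + 2 * t₂               ≡⟨ cong (λ y → bOf y + 2 * c₂ + 2 * t₂) x₂≡ ⟩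
    bOf (1 + 2 * k) + 2 * c₂ + 2 * t₂      ≡⟨ cong (λ y → y + 2 * c₂ + 2 * t₂) (bOf-1+2* k) ⟩
    1 + 2 * (k * k) + 2 * c₂ + 2 * t₂      ≡⟨ cong (_+ 2 * t₂) (1+2*-+-2* (k * k) c₂) ⟩
    1 + 2 * (k * k + c₂) + 2 * t₂          ≡⟨ 1+2*-+-2* (k * k + c₂) t₂ ⟩
    1 + 2 * (k * k + c₂ + t₂)              ∎
    where open ≡-Reasoning
  odd₁ : Odd x₁
  odd₁ = odd-1+2* j
  odd₂ : Odd x₂
  odd₂ = subst Odd (sym x₂≡) (odd-1+2* k)
  odd₃ : Odd x₃
  odd₃ = subst Odd (sym x₃≡) (odd-1+2* (k * k + c₂ + t₂))
  x₂-below : ∀ m → x₂ ≡ 3 + 2 * m → unitSum (x₂ ∷ x₃ ∷ []) ℚ.< unit (1 + 2 * m)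
  x₂-below m x₂≡3+2m = subst (λ y → unitSum (y ∷ x₃Of y c₂ t₂ ∷ []) ℚ.< unit (1 + 2 * m)) (sym x₂≡3+2m)
    (x₂-bound m (bOf≤x₃Of (3 + 2 * m) c₂ t₂))

corollary5p3 : (x₁ : ℕ) → 1 ≤ x₁ → x₁ % 2 ≡ 1 →
    (c₂ : ℕ) → c₂Condition x₁ c₂ →
    (t₁ t₂ : ℕ) →
    let x₂ = bOf x₁ + 2 * t₁
        x₃ = x₃Of x₂ c₂ t₂
    in  OddGreedy (ℕ→ℚ (σ₂ x₁ x₂ x₃) ÷ᵗ ℕ→ℚ (x₁ * x₂ * x₃)) (x₁ ∷ x₂ ∷ x₃ ∷ [])
-- 1 ≤ x₁ follows from x₁ % 2 ≡ 1.  Transporting along x₁ ≡ 1 + 2 * j, rather than matching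
-- on it, keeps 1 + 2 * j unnormalised; otherwise conversion checking evaluates unit fractions.
corollary5p3 x₁ _ x₁%2≡1 c₂ cond t₁ t₂ =
  subst Expansion (sym x₁≡) (oddGreedy-σ₂/product j c₂ t₁ t₂ (subst (λ x → c₂Condition x c₂) x₁≡ cond))
  where
  j = proj₁ (%2≡1⇒1+2* {x₁} x₁%2≡1)
  x₁≡ : x₁ ≡ 1 + 2 * j
  x₁≡ = proj₂ (%2≡1⇒1+2* {x₁} x₁%2≡1)
  Expansion : ℕ → Set
  Expansion x = let y = bOf x + 2 * t₁ ; z = x₃Of y c₂ t₂ in
    OddGreedy (ℕ→ℚ (σ₂ x y z) ÷ᵗ ℕ→ℚ (x * y * z)) (x ∷ y ∷ z ∷ [])
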